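{- Let $(D,F=(f_1,\dots,f_s))$ be a tight valid pair such that $D$ is not biconnected, and let $B$ be a hard end-block of $D$ with cut-vertex $x$. Let $(D',F')$ be the contraction of $(D,F)$ with respect to $B$. Then $(D,F)$ is a hard pair if and only if $(D',F')$ is a hard pair.
   Context: Digraphs are finite, without loops or parallel arcs (digons allowed). $f_i=(f_i^-,f_i^+):V(D)\to\mathbb{N}^2$; $\mathbb{N}^2$ is ordered and added componentwise. Connectivity notions refer to the underlying undirected graph; biconnected means at least two vertices and connected after deleting any vertex; a block is a maximal biconnected subdigraph, a cut-vertex is one whose deletion disconnects, an end-block is a block containing at most one cut-vertex. $(D,F)$ is valid if $D$ is connected and $\sum_i f_i^-(v)\ge d^-(v)$, $\sum_i f_i^+(v)\ge d^+(v)$ for all $v$; tight if these are equalities. Hard pairs: (i) $D$ biconnected and some $i$ with $f_i(v)=(d^-(v),d^+(v))$, $f_k(v)=(0,0)$ ($k\ne i$) for all $v$; (ii) $D$ a bidirected odd cycle, all $f_k$ constantly $(0,0)$ except exactly two constantly $(1,1)$; (iii) $D$ a bidirected complete graph, all $f_k$ constant and symmetric ($f_k^-=f_k^+$), $\sum_kf_k^+(v)=|V(D)|-1$; (iv) obtained from two hard pairs $(D^1,F^1),(D^2,F^2)$ on disjoint vertex sets by identifying $x_1\in V(D^1),x_2\in V(D^2)$ into $x$, with $f_k=f^1_k$ on $V(D^1)\setminus\{x_1\}$, $f_k=f^2_k$ on $V(D^2)\setminus\{x_2\}$, $f_k(x)=f^1_k(x_1)+f^2_k(x_2)$. An end-block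 $B$ with cut-vertex $x$ is a hard end-block if: (i) (monochromatic) some $i$ has $f_i(x)\ge(d_B^-(x),d_B^+(x))$ and for every $v\in V(B)\setminus\{x\}$, $f_i(v)=(d_B^-(v),d_B^+(v))$ and $f_k(v)=(0,0)$ for $k\ne i$; or (ii) (bicycle) $B$ is a bidirected odd cycle and there are colours $i\ne j$ with $f_i(x)\ge(1,1)$, $f_j(x)\ge(1,1)$ and, for all $v\in V(B)\setminus\{x\}$, $f_c(v)=(1,1)$ for $c\in\{i,j\}$ and $(0,0)$ otherwise; or (iii) (complete) $B$ is a bidirected complete graph, all $f_k$ are constant and symmetric on $V(B)\setminus\{x\}$, and $f_i(x)\ge f_i(u)$ for all $i$ and $u\in V(B)\setminus\{x\}$. The contraction $(D',F')$ of $(D,F)$ with respect to $B$ (fix $u\in V(B)\setminus\{x\}$): $D'=D-(V(B)\setminus\{x\})$; $f_i'(v)=f_i(v)$ for $v\ne x$; if $B$ is a monochromatic hard end-block and $c$ is the unique colour with $f_c(u)\ne(0,0)$, then $f'_c(x)=f_c(x)-(d_B^-(x),d_B^+(x))$ and $f_i'(x)=f_i(x)$ for $i\ne c$; otherwise $f_i'(x)=f_i(x)-f_i(u)$ for all $i$. -}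

module Defs where

open import Data.Nat using (ℕ; zero; suc; _+_; _*_; _∸_; _≤_)
open import Data.Nat.DivMod using (_%_)
open import Data.Fin using (Fin; zero; suc; toℕ)
open import Data.Fin.Properties using (_≟_)
open import Data.Bool using (Bool; true; false; _∧_; _∨_; not; if_then_else_)
open import Data.Product using (Σ; ∃; ∃-syntax; Σ-syntax; _×_; _,_; proj₁; proj₂)
open import Data.Sum using (_⊎_)
open import Relation.Nullary using (¬_; does)
open import Relation.Binary.PropositionalEquality using (_≡_; _≢_)
open import Function.Bundles using (_⇔_)

ℕ² : Set
ℕ² = ℕ × ℕ

_≤²_ : ℕ² → ℕ² → Set
(a , b) ≤² (c , d) = (a ≤ c) × (b ≤ d)

_+²_ : ℕ² → ℕ² → ℕ²
(a , b) +² (c , d) = (a + c , b + d)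

-- only used where the subtrahend is ≤ the minuend (so it is exact)
_∸²_ : ℕ² → ℕ² → ℕ²
(a , b) ∸² (c , d) = (a ∸ c , b ∸ d)

𝟘 : ℕ²
𝟘 = (0 , 0)

𝟙 : ℕ²
𝟙 = (1 , 1)

count : ∀ {n} → (Fin n → Bool) → ℕ
count {zero}  P = 0
count {suc n} P = (if P zero then 1 else 0) + count (λ i → P (suc i))

sumFin : ∀ {s} → (Fin s → ℕ) → ℕ
sumFin {zero}  f = 0
sumFin {suc s} f = f zero + sumFin (λ i → f (suc i))

-- Digraphs on vertex set Fin n: an arc relation (so no parallel arcs),
-- loopless, digons allowed.

record Digraph (n : ℕ) : Set where
  field
    arc      : Fin n → Fin n → Bool
    loopless : ∀ v → arc v v ≡ false
open Digraph public

-- vertex subsets; a subset S of V(D) stands for the induced subdigraph D[S]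
VSet : ℕ → Set
VSet n = Fin n → Bool

_∈ᵥ_ : ∀ {n} → Fin n → VSet n → Set
v ∈ᵥ S = S v ≡ true

_⊆ᵥ_ : ∀ {n} → VSet n → VSet n → Set
S ⊆ᵥ T = ∀ v → v ∈ᵥ S → v ∈ᵥ T

full : ∀ {n} → VSet n
full _ = true

remove : ∀ {n} → VSet n → Fin n → VSet n
remove S w v = S v ∧ not (does (v ≟ w))

Col : ℕ → ℕ → Set
Col s n = Fin s → Fin n → ℕ²

module _ {n : ℕ} (D : Digraph n) where

  indeg : VSet n → Fin n → ℕ
  indeg S v = count (λ u → S u ∧ arc D u v)

  outdeg : VSet n → Fin n → ℕ
  outdeg S v = count (λ w → S w ∧ arc D v w)

  deg : VSet n → Fin n → ℕ²
  deg S v = (indeg S v , outdeg S v)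

  adjacent : Fin n → Fin n → Bool
  adjacent u v = arc D u v ∨ arc D v u

  data Reach (S : VSet n) (u : Fin n) : Fin n → Set where
    here : u ∈ᵥ S → Reach S u u
    step : ∀ {w v} → Reach S u w → adjacent w v ≡ true → v ∈ᵥ S → Reach S u v

  Connected : VSet n → Set
  Connected S = ∀ u v → u ∈ᵥ S → v ∈ᵥ S → Reach S u v

  Biconnected : VSet n → Set
  Biconnected S =
    (Σ[ u ∈ Fin n ] Σ[ v ∈ Fin n ] (u ∈ᵥ S × v ∈ᵥ S × u ≢ v))
    × Connected S
    × (∀ w → w ∈ᵥ S → Connected (remove S w))

  -- blocks of D[S] (maximal biconnected subdigraphs; these are induced)
  IsBlock : VSet n → VSet n → Set
  IsBlock S B = B ⊆ᵥ S × Biconnected B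
              × (∀ T → B ⊆ᵥ T → T ⊆ᵥ S → Biconnected T → T ⊆ᵥ B)

  CutVertex : VSet n → Fin n → Set
  CutVertex S x = x ∈ᵥ S × ¬ Connected (remove S x)

  EndBlockAt : VSet n → VSet n → Fin n → Set
  EndBlockAt S B x = IsBlock S B × x ∈ᵥ B × CutVertex S x
                   × (∀ y → y ∈ᵥ B → CutVertex S y → y ≡ x)

  -- D[S] is a bidirected odd cycle: the vertices of S are c 0, …, c (L-1)
  -- (distinct), L = 2k+3, and c i → c j is an arc iff i, j are cyclically
  -- consecutive.
  BidirectedOddCycle : VSet n → Set
  BidirectedOddCycle S =
    Σ[ k ∈ ℕ ] Σ[ c ∈ (Fin (suc (suc (suc (2 * k)))) → Fin n) ]
      (∀ i j → c i ≡ c j → i ≡ j)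
      × (∀ i → c i ∈ᵥ S)
      × (∀ v → v ∈ᵥ S → ∃[ i ] c i ≡ v)
      × (∀ i j → (arc D (c i) (c j) ≡ true) ⇔
           ((toℕ j ≡ suc (toℕ i) % suc (suc (suc (2 * k))))
            ⊎ (toℕ i ≡ suc (toℕ j) % suc (suc (suc (2 * k))))))

  BidirectedComplete : VSet n → Set
  BidirectedComplete S = ∀ u v → u ∈ᵥ S → v ∈ᵥ S → u ≢ v → arc D u v ≡ true

  TightValid : ∀ {s} → Col s n → Set
  TightValid F = Connected full
    × (∀ v → sumFin (λ k → proj₁ (F k v)) ≡ indeg full v
           × sumFin (λ k → proj₂ (F k v)) ≡ outdeg full v)

  -- hard pairs (D[S], F|S); type (iv) is expressed as a decomposition of S
  -- into two parts sharing exactly one vertex x with no arcs between them.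
  data Hard {s : ℕ} : VSet n → Col s n → Set where
    mono : ∀ {S F} → Biconnected S → (i : Fin s) →
      (∀ v → v ∈ᵥ S → (F i v ≡ deg S v) × (∀ k → k ≢ i → F k v ≡ 𝟘)) →
      Hard S F
    cycle : ∀ {S F} → BidirectedOddCycle S → (i j : Fin s) → i ≢ j →
      (∀ v → v ∈ᵥ S → (F i v ≡ 𝟙) × (F j v ≡ 𝟙)
                      × (∀ k → k ≢ i → k ≢ j → F k v ≡ 𝟘)) →
      Hard S F
    complete : ∀ {S F} → BidirectedComplete S →
      (∀ k u v → u ∈ᵥ S → v ∈ᵥ S → F k u ≡ F k v) →
      (∀ k v → v ∈ᵥ S → proj₁ (F k v) ≡ proj₂ (F k v)) →
      (∀ v → v ∈ᵥ S → sumFin (λ k → proj₂ (F k v)) ≡ count S ∸ 1) →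
      Hard S F
    glue : ∀ {S F} (x : Fin n) (S₁ S₂ : VSet n) (F₁ F₂ : Col s n) →
      x ∈ᵥ S₁ → x ∈ᵥ S₂ →
      (∀ v → S v ≡ (S₁ v ∨ S₂ v)) →
      (∀ v → v ∈ᵥ S₁ → v ∈ᵥ S₂ → v ≡ x) →
      (∀ u v → u ∈ᵥ S₁ → v ∈ᵥ S₂ → u ≢ x → v ≢ x →
         (arc D u v ≡ false) × (arc D v u ≡ false)) →
      (∀ k v → v ∈ᵥ S₁ → v ≢ x → F k v ≡ F₁ k v) →
      (∀ k v → v ∈ᵥ S₂ → v ≢ x → F k v ≡ F₂ k v) →
      (∀ k → F k x ≡ F₁ k x +² F₂ k x) →
      Hard S₁ F₁ → Hard S₂ F₂ → Hard S F

  MonoEB : ∀ {s} → Col s n → VSet n → Fin n → Set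
  MonoEB {s} F B x = Σ[ i ∈ Fin s ] (deg B x ≤² F i x)
    × (∀ v → v ∈ᵥ B → v ≢ x → (F i v ≡ deg B v) × (∀ k → k ≢ i → F k v ≡ 𝟘))

  BicycleEB : ∀ {s} → Col s n → VSet n → Fin n → Set
  BicycleEB {s} F B x = BidirectedOddCycle B
    × Σ[ i ∈ Fin s ] Σ[ j ∈ Fin s ] (i ≢ j) × (𝟙 ≤² F i x) × (𝟙 ≤² F j x)
      × (∀ v → v ∈ᵥ B → v ≢ x → (F i v ≡ 𝟙) × (F j v ≡ 𝟙)
                               × (∀ c → c ≢ i → c ≢ j → F c v ≡ 𝟘))

  CompleteEB : ∀ {s} → Col s n → VSet n → Fin n → Set
  CompleteEB F B x = BidirectedComplete B
    × (∀ k u v → u ∈ᵥ B → v ∈ᵥ B → u ≢ x → v ≢ x → F k u ≡ F k v)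
    × (∀ k u → u ∈ᵥ B → u ≢ x → proj₁ (F k u) ≡ proj₂ (F k u))
    × (∀ k u → u ∈ᵥ B → u ≢ x → F k u ≤² F k x)

  HardEndBlock : ∀ {s} → Col s n → VSet n → Fin n → Set
  HardEndBlock F B x = EndBlockAt full B x
    × (MonoEB F B x ⊎ BicycleEB F B x ⊎ CompleteEB F B x)

  IsContraction : ∀ {s} → VSet n → Fin n → Fin n → Col s n → Col s n → Set
  IsContraction B x u F F' =
    (∀ k v → v ≢ x → F' k v ≡ F k v)
    × (MonoEB F B x → ∀ k → (F k u ≢ 𝟘 → F' k x ≡ F k x ∸² deg B x)
                          × (F k u ≡ 𝟘 → F' k x ≡ F k x))
    × (¬ MonoEB F B x → ∀ k → F' k x ≡ F k x ∸² F k u)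

contractSet : ∀ {n} → VSet n → Fin n → VSet n
contractSet B x v = not (B v) ∨ does (v ≟ x)

-- Since B - x is joined to the rest of D only through x, every derivation of (D, F) as a hard
-- pair contains B as one base piece of type (i)-(iii): a biconnected subdigraph of a glued pair
-- lies on one side of the glue, and a base piece containing the block B is B itself by
-- maximality. Removing that piece, and its demand at x, from the derivation gives one of (D', F'),
-- and the contraction subtracts exactly this demand. Conversely, (D, F) is the gluing at x of
-- (D', F') with the hard pair on B described by the hard end-block.

module Submission where

open import Data.Bool using (Bool; true; false; _∧_; _∨_; not)
open import Data.Bool.Properties
  using ( ∨-comm; ∨-identityʳ; ∨-zeroʳ; ∨-conicalˡ; ∨-conicalʳ
        ; ∧-identityʳ; ∧-zeroʳ; ∧-conicalˡ; ∧-conicalʳ; ¬-not)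
  renaming (_≟_ to _≟ᵇ_)
open import Data.Empty using (⊥-elim)
open import Data.Fin using (Fin; zero; suc; toℕ; fromℕ<)
open import Data.Fin.Properties using (_≟_; toℕ-fromℕ<; fromℕ<-toℕ; toℕ<n)
open import Data.List using (List; []; _∷_)
open import Data.List.Membership.Propositional using (_∈_; _∉_)
open import Data.List.Relation.Binary.Subset.Propositional using (_⊆_)
open import Data.List.Relation.Unary.All as All using (All; []; _∷_)
open import Data.List.Relation.Unary.All.Properties using (anti-mono; ¬Any⇒All¬)
open import Data.List.Relation.Unary.Any using (Any; here; there; any?)
open import Data.Nat using (ℕ; zero; suc; _+_; _∸_; _≤_; _<_; z≤n; s≤s)
open import Data.Nat.DivMod using (_%_; m<n⇒m%n≡m; n%n≡0)
import Data.Nat.Properties as ℕ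
open import Data.Product using (∃-syntax; Σ-syntax; _×_; _,_; proj₁; proj₂; swap)
open import Data.Product.Properties using (≡-dec)
open import Data.Sum using (_⊎_; inj₁; inj₂; [_,_]′)
open import Function.Base using (_∘_)
open import Function.Bundles using (_⇔_; mk⇔; Equivalence)
open import Relation.Binary.Definitions using (tri<; tri≈; tri>)
open import Relation.Binary.PropositionalEquality
open import Relation.Nullary using (¬_; Dec; yes; no; does)
open import Relation.Nullary.Decidable using (dec-true; dec-false)

open import Defs

true≢false : true ≢ false
true≢false ()

does⇒ : ∀ {a} {A : Set a} (d : Dec A) → does d ≡ true → A
does⇒ (yes a) _ = a

_∪ᵥ_ : ∀ {n} → VSet n → VSet n → VSet n
(S ∪ᵥ T) v = S v ∨ T v

∨-introˡ : ∀ {a b} → a ≡ true → (a ∨ b) ≡ true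
∨-introˡ refl = refl

∨-introʳ : ∀ {a b} → b ≡ true → (a ∨ b) ≡ true
∨-introʳ {true}  _    = refl
∨-introʳ {false} b≡tt = b≡tt

∨-elim : ∀ {a b} → (a ∨ b) ≡ true → a ≡ true ⊎ b ≡ true
∨-elim {true}  _    = inj₁ refl
∨-elim {false} b≡tt = inj₂ b≡tt

∨-∧-absorbʳ : ∀ a b c → (b ≡ true → c ≡ true) → ((a ∨ b) ∧ c) ≡ ((a ∧ c) ∨ b)
∨-∧-absorbʳ a true  c c-true rewrite c-true refl | ∨-zeroʳ a | ∨-zeroʳ (a ∧ true) = refl
∨-∧-absorbʳ a false c _      rewrite ∨-identityʳ a | ∨-identityʳ (a ∧ c) = refl

module _ {n : ℕ} where

  ⊆-antisym : ∀ {S T : VSet n} → S ⊆ᵥ T → T ⊆ᵥ S → ∀ v → S v ≡ T v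
  ⊆-antisym {S} {T} S⊆T T⊆S v with S v in Sv
  ... | true = sym (S⊆T v Sv)
  ... | false with T v in Tv
  ...   | true  = trans (sym Sv) (T⊆S v Tv)
  ...   | false = refl

  module _ (S : VSet n) {w : Fin n} where

    ∈-remove⁺ : ∀ {v} → v ∈ᵥ S → v ≢ w → v ∈ᵥ remove S w
    ∈-remove⁺ {v} v∈S v≢w rewrite v∈S | dec-false (v ≟ w) v≢w = refl

    ∈-remove⁻ : ∀ {v} → v ∈ᵥ remove S w → v ∈ᵥ S
    ∈-remove⁻ = ∧-conicalˡ _ _

    ∈-remove-≢ : ∀ {v} → v ∈ᵥ remove S w → v ≢ w
    ∈-remove-≢ {v} v∈ v≡w =
      true≢false (trans (sym (∧-conicalʳ _ _ v∈)) (cong not (dec-true (v ≟ w) v≡w)))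

count-cong : ∀ {n} {P Q : Fin n → Bool} → (∀ v → P v ≡ Q v) → count P ≡ count Q
count-cong {zero}  P≗Q = refl
count-cong {suc n} P≗Q rewrite P≗Q zero = cong (_ +_) (count-cong (λ i → P≗Q (suc i)))

count≢0 : ∀ {n} {P : Fin n → Bool} v → P v ≡ true → count P ≢ 0
count≢0 {P = P} zero    Pv rewrite Pv = λ ()
count≢0 {P = P} (suc v) Pv with P zero
... | true  = λ ()
... | false = count≢0 v Pv

count-empty : ∀ {n} {P : Fin n → Bool} → (∀ v → P v ≡ false) → count P ≡ 0
count-empty {zero}  _     = refl
count-empty {suc n} empty rewrite empty zero = count-empty (λ i → empty (suc i))

count-remove : ∀ {n} (P : Fin n → Bool) u → P u ≡ true → count P ≡ suc (count (remove P u))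
count-remove P zero Pu rewrite Pu =
  cong suc (count-cong (λ i → sym (∧-identityʳ (P (suc i)))))
count-remove P (suc u) Pu
  rewrite ∧-identityʳ (P zero) | count-remove (λ i → P (suc i)) u Pu with P zero
... | true  = refl
... | false = refl

count-subsingleton : ∀ {n} {P : Fin n → Bool} y → (∀ v → P v ≡ true → v ≡ y) → count P ∸ 1 ≡ 0
count-subsingleton {P = P} y only-y with P y in Py
... | true rewrite count-remove P y Py = count-empty removed
  where
    removed : ∀ v → remove P y v ≡ false
    removed v with P v in Pv
    ... | true  = cong not (dec-true (v ≟ y) (only-y v Pv))
    ... | false = refl
... | false = cong (_∸ 1) (count-empty empty)
  where
    empty : ∀ v → P v ≡ false
    empty v = ¬-not (λ Pv → true≢false (trans (sym Pv) (trans (cong P (only-y v Pv)) Py)))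

sumFin-zero : ∀ {s} {f : Fin s → ℕ} → (∀ k → f k ≡ 0) → sumFin f ≡ 0
sumFin-zero {zero}  _ = refl
sumFin-zero {suc s} f≗0 rewrite f≗0 zero = sumFin-zero (λ k → f≗0 (suc k))

sumFin≡0⇒ : ∀ {s} {f : Fin s → ℕ} → sumFin f ≡ 0 → ∀ k → f k ≡ 0
sumFin≡0⇒ {f = f} Σ≡0 zero    = ℕ.m+n≡0⇒m≡0 (f zero) Σ≡0
sumFin≡0⇒ {f = f} Σ≡0 (suc k) = sumFin≡0⇒ (ℕ.m+n≡0⇒n≡0 (f zero) Σ≡0) k

≤²-refl : ∀ {a} → a ≤² a
≤²-refl = ℕ.≤-refl , ℕ.≤-refl

≤²-trans : ∀ {a b c} → a ≤² b → b ≤² c → a ≤² c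
≤²-trans (p , q) (p' , q') = ℕ.≤-trans p p' , ℕ.≤-trans q q'

≤²-+ : ∀ a b → a ≤² (a +² b)
≤²-+ (a₁ , a₂) (b₁ , b₂) = ℕ.m≤m+n a₁ b₁ , ℕ.m≤m+n a₂ b₂

+²-identityʳ : ∀ a → a +² 𝟘 ≡ a
+²-identityʳ (a₁ , a₂) = cong₂ _,_ (ℕ.+-identityʳ a₁) (ℕ.+-identityʳ a₂)

+²-comm : ∀ a b → a +² b ≡ b +² a
+²-comm (a₁ , a₂) (b₁ , b₂) = cong₂ _,_ (ℕ.+-comm a₁ b₁) (ℕ.+-comm a₂ b₂)

∸²-self : ∀ a → a ∸² a ≡ 𝟘
∸²-self (a₁ , a₂) = cong₂ _,_ (ℕ.n∸n≡0 a₁) (ℕ.n∸n≡0 a₂)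

+-∸²-comm : ∀ a b c → c ≤² a → (a +² b) ∸² c ≡ (a ∸² c) +² b
+-∸²-comm (a₁ , a₂) (b₁ , b₂) _ (p , q) = cong₂ _,_ (ℕ.+-∸-comm b₁ p) (ℕ.+-∸-comm b₂ q)

+-∸²-cancel : ∀ a b → a ≤² b → b ≡ a +² (b ∸² a)
+-∸²-cancel _ _ (p , q) = cong₂ _,_ (sym (ℕ.m+[n∸m]≡n p)) (sym (ℕ.m+[n∸m]≡n q))

update : ∀ {s n} → Col s n → Fin n → (Fin s → ℕ²) → Col s n
update F z c k v with v ≟ z
... | yes _ = c k
... | no  _ = F k v

update-same : ∀ {s n} (F : Col s n) z c k → update F z c k z ≡ c k
update-same F z c k with z ≟ z
... | yes _   = refl
... | no  z≢z = ⊥-elim (z≢z refl)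

update-other : ∀ {s n} (F : Col s n) {z} c k {v} → v ≢ z → update F z c k v ≡ F k v
update-other F {z} c k {v} v≢z with v ≟ z
... | yes v≡z = ⊥-elim (v≢z v≡z)
... | no  _   = refl

-- Walks and simple paths in the underlying graph

module Reachability {n : ℕ} (D : Digraph n) where

  private variable
    S T : VSet n
    u v w : Fin n

  adjacent-sym : adjacent D u v ≡ true → adjacent D v u ≡ true
  adjacent-sym {u} {v} u~v = trans (∨-comm (arc D v u) (arc D u v)) u~v

  arc⇒adjacent : arc D u v ≡ true → adjacent D u v ≡ true
  arc⇒adjacent u→v rewrite u→v = refl

  adjacent-irrefl : ∀ v → adjacent D v v ≡ false
  adjacent-irrefl v = cong₂ _∨_ (loopless D v) (loopless D v)

  reach-source : Reach D S u v → u ∈ᵥ S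
  reach-source (here u∈S)   = u∈S
  reach-source (step r _ _) = reach-source r

  reach-target : Reach D S u v → v ∈ᵥ S
  reach-target (here u∈S)     = u∈S
  reach-target (step _ _ v∈S) = v∈S

  reach-mono : S ⊆ᵥ T → Reach D S u v → Reach D T u v
  reach-mono S⊆T (here u∈S)       = here (S⊆T _ u∈S)
  reach-mono S⊆T (step r w~v v∈S) = step (reach-mono S⊆T r) w~v (S⊆T _ v∈S)

  reach-trans : Reach D S u w → Reach D S w v → Reach D S u v
  reach-trans r (here _)          = r
  reach-trans r (step r' w~v v∈S) = step (reach-trans r r') w~v v∈S

  reach-adjacent : u ∈ᵥ S → v ∈ᵥ S → adjacent D u v ≡ true → Reach D S u v
  reach-adjacent u∈S v∈S u~v = step (here u∈S) u~v v∈S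

  reach-sym : Reach D S u v → Reach D S v u
  reach-sym (here u∈S)       = here u∈S
  reach-sym (step r w~v v∈S) =
    reach-trans (reach-adjacent v∈S (reach-target r) (adjacent-sym w~v)) (reach-sym r)

  reach-closed : (C : VSet n) → Reach D S u v → u ∈ᵥ C →
    (∀ w w' → w ∈ᵥ S → w' ∈ᵥ S → w ∈ᵥ C → adjacent D w w' ≡ true → w' ∈ᵥ C) → v ∈ᵥ C
  reach-closed C (here _)         u∈C closed = u∈C
  reach-closed C (step r w~v v∈S) u∈C closed =
    closed _ _ (reach-target r) v∈S (reach-closed C r u∈C closed) w~v

  reach-neighbour : Reach D S u v → u ≢ v → ∃[ w ] (w ∈ᵥ S × adjacent D u w ≡ true)
  reach-neighbour (here _) u≢v = ⊥-elim (u≢v refl)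
  reach-neighbour {u = u} (step {w = w} r w~v v∈S) u≢v with u ≟ w
  ... | yes refl = _ , v∈S , w~v
  ... | no u≢w   = reach-neighbour r u≢w

  other-vertex : Biconnected D S → ∀ u → ∃[ w ] (w ∈ᵥ S × u ≢ w)
  other-vertex ((u₀ , u₁ , u₀∈S , u₁∈S , u₀≢u₁) , _) u with u ≟ u₀
  ... | yes refl = u₁ , u₁∈S , u₀≢u₁
  ... | no u≢u₀  = u₀ , u₀∈S , u≢u₀

module Paths {n : ℕ} (D : Digraph n) where
  open import Data.List.Membership.DecPropositional (_≟_ {n}) using (_∈?_)

  -- Path b v ws: a simple path from b to v; ws lists the earlier vertices, nearest first.
  data Path (b : Fin n) : Fin n → List (Fin n) → Set where
    start  : Path b b []
    extend : ∀ {w ws v} → Path b w ws → adjacent D w v ≡ true → v ∉ w ∷ ws → Path b v (w ∷ ws)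

  truncate : ∀ {b h ws v} → Path b h ws → v ∈ h ∷ ws →
    ∃[ zs ] (Path b v zs × v ∷ zs ⊆ h ∷ ws)
  truncate P              (here refl) = _ , P , λ z∈ → z∈
  truncate start          (there ())
  truncate (extend P _ _) (there v∈) with truncate P v∈
  ... | zs , Q , sub = zs , Q , λ z∈ → there (sub z∈)

  simple-path : ∀ {S b v} → Reach D S b v → ∃[ ws ] (Path b v ws × All (_∈ᵥ S) (v ∷ ws))
  simple-path (here b∈S) = [] , start , b∈S ∷ []
  simple-path (step {w = w} {v = v} r w~v v∈S) with simple-path r
  ... | ws , P , inS with v ∈? w ∷ ws
  ...   | no v∉ = w ∷ ws , extend P w~v v∉ , v∈S ∷ inS
  ...   | yes v∈ with truncate P v∈
  ...     | zs , Q , sub = zs , Q , anti-mono sub inS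

  path-reach : ∀ {X b h ws v} → Path b h ws → All (_∈ᵥ X) (h ∷ ws) → v ∈ h ∷ ws →
    Reach D X v h × Reach D X b v
  path-reach start (b∈X ∷ []) (here refl) = here b∈X , here b∈X
  path-reach start _ (there ())
  path-reach (extend P w~h _) (h∈X ∷ inX) (here refl) =
    here h∈X , step (proj₂ (path-reach P inX (here refl))) w~h h∈X
  path-reach (extend P w~h _) (h∈X ∷ inX) (there v∈) with path-reach P inX v∈
  ... | v⇝w , b⇝v = step v⇝w w~h h∈X , b⇝v

  path-split : ∀ {X b h ws v w} → Path b h ws → (∀ {z} → z ∈ h ∷ ws → z ≢ w → z ∈ᵥ X) →
    w ∈ h ∷ ws → v ∈ h ∷ ws → v ≢ w → Reach D X v h ⊎ Reach D X b v
  path-split P inX w∈ (here refl) v≢w = inj₁ (here (inX (here refl) v≢w))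
  path-split start inX w∈ (there ()) v≢w
  path-split (extend P w~h h∉) inX (here refl) (there v∈) v≢w =
    inj₂ (proj₂ (path-reach P (All.tabulate (λ z∈ → inX (there z∈) (λ { refl → h∉ z∈ }))) v∈))
  path-split (extend P w~h h∉) inX (there w∈) (there v∈) v≢w
    with path-split P (λ z∈ → inX (there z∈)) w∈ v∈ v≢w
  ... | inj₁ v⇝ = inj₁ (step v⇝ w~h (inX (here refl) (λ { refl → h∉ w∈ })))
  ... | inj₂ ⇝v = inj₂ ⇝v

  first-entry : (C : VSet n) → ∀ {b h ws} → Path b h ws → C b ≡ false → Any (_∈ᵥ C) (h ∷ ws) →
    Σ[ q ∈ Fin n ] Σ[ p ∈ Fin n ] Σ[ zs ∈ List (Fin n) ]
      Path b p zs × adjacent D p q ≡ true × q ∈ᵥ C × q ∈ h ∷ ws × All (λ z → C z ≡ false) (p ∷ zs)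
  first-entry C start b∉C (here b∈C) = ⊥-elim (true≢false (trans (sym b∈C) b∉C))
  first-entry C start b∉C (there ())
  first-entry C (extend {w} {ws} P w~h _) b∉C hit with any? (λ z → C z ≟ᵇ true) (w ∷ ws)
  ... | yes earlier with first-entry C P b∉C earlier
  ...   | q , p , zs , Q , p~q , q∈C , q∈ , outside = q , p , zs , Q , p~q , q∈C , there q∈ , outside
  first-entry C {h = h} (extend {w} {ws} P w~h _) b∉C (here h∈C) | no none =
    h , w , ws , P , w~h , h∈C , here refl , All.map ¬-not (¬Any⇒All¬ (w ∷ ws) none)
  first-entry C (extend P _ _) b∉C (there hit) | no none = ⊥-elim (none hit)

-- Blocks

module Blocks {n : ℕ} (D : Digraph n) where
  open Reachability D
  open Paths D
  open import Data.List.Membership.DecPropositional (_≟_ {n}) using (_∈?_)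

  remove-connected : ∀ {T} → Biconnected D T → ∀ w → Connected D (remove T w)
  remove-connected {T} (_ , conT , conT-w) w with T w in Tw
  ... | true  = conT-w w Tw
  ... | false = λ a b a∈ b∈ →
    reach-mono (λ v v∈T → ∈-remove⁺ T v∈T (λ { refl → true≢false (trans (sym v∈T) Tw) }))
               (conT a b (∈-remove⁻ T a∈) (∈-remove⁻ T b∈))

  biconnected-grow : ∀ {T U} → T ⊆ᵥ U → Biconnected D T →
    (∀ w v → v ∈ᵥ U → T v ≡ false → v ≢ w →
       ∃[ t ] (t ∈ᵥ T × t ≢ w × Reach D (remove U w) v t)) →
    Biconnected D U
  biconnected-grow {T} {U} T⊆U bicT@((u₀ , u₁ , u₀∈T , u₁∈T , u₀≢u₁) , conT , _) reroute =
    (u₀ , u₁ , T⊆U _ u₀∈T , T⊆U _ u₁∈T , u₀≢u₁) , conU , conU-w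
    where
      into-T : ∀ v → v ∈ᵥ U → ∃[ t ] (t ∈ᵥ T × Reach D U v t)
      into-T v v∈U with T v in Tv
      ... | true  = v , Tv , here v∈U
      ... | false with reroute u₀ v v∈U Tv (λ { refl → true≢false (trans (sym u₀∈T) Tv) })
      ...   | t , t∈T , _ , v⇝t = t , t∈T , reach-mono (λ _ → ∈-remove⁻ U) v⇝t

      conU : Connected D U
      conU a b a∈U b∈U with into-T a a∈U | into-T b b∈U
      ... | ta , ta∈T , a⇝ | tb , tb∈T , b⇝ =
        reach-trans a⇝ (reach-trans (reach-mono T⊆U (conT ta tb ta∈T tb∈T)) (reach-sym b⇝))

      into-T-w : ∀ w v → v ∈ᵥ remove U w → ∃[ t ] (t ∈ᵥ T × t ≢ w × Reach D (remove U w) v t)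
      into-T-w w v v∈ with T v in Tv
      ... | true  = v , Tv , ∈-remove-≢ U v∈ , here v∈
      ... | false = reroute w v (∈-remove⁻ U v∈) Tv (∈-remove-≢ U v∈)

      conU-w : ∀ w → w ∈ᵥ U → Connected D (remove U w)
      conU-w w _ a b a∈ b∈ with into-T-w w a a∈ | into-T-w w b b∈
      ... | ta , ta∈T , ta≢w , a⇝ | tb , tb∈T , tb≢w , b⇝ =
        reach-trans a⇝ (reach-trans (reach-mono T-w⊆U-w T-w⇝) (reach-sym b⇝))
        where
          T-w⊆U-w : remove T w ⊆ᵥ remove U w
          T-w⊆U-w v v∈ = ∈-remove⁺ U (T⊆U v (∈-remove⁻ T v∈)) (∈-remove-≢ T v∈)
          T-w⇝ : Reach D (remove T w) ta tb
          T-w⇝ = remove-connected bicT w ta tb (∈-remove⁺ T ta∈T ta≢w) (∈-remove⁺ T tb∈T tb≢w)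

  listSet : List (Fin n) → VSet n
  listSet L v = does (v ∈? L)

  ear-biconnected : ∀ {B a q b p zs} → Biconnected D B → a ∈ᵥ B → q ∈ᵥ B → q ≢ a →
    Path b p zs → adjacent D b a ≡ true → adjacent D p q ≡ true →
    All (λ z → B z ≡ false) (p ∷ zs) → Biconnected D (B ∪ᵥ listSet (p ∷ zs))
  ear-biconnected {B} {a} {q} {b} {p} {zs} bicB a∈B q∈B q≢a P b~a p~q outside =
    biconnected-grow {U = U} (λ _ → ∨-introˡ) bicB reroute
    where
      U : VSet n
      U = B ∪ᵥ listSet (p ∷ zs)

      on-ear : ∀ {z} → z ∈ p ∷ zs → z ∈ᵥ U
      on-ear {z} z∈ = ∨-introʳ {a = B z} (dec-true (z ∈? p ∷ zs) z∈)

      off-ear : ∀ {z w} → z ∈ᵥ B → w ∈ p ∷ zs → w ≢ z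
      off-ear z∈B w∈ refl = true≢false (trans (sym z∈B) (All.lookup outside w∈))

      Rerouted : Fin n → Fin n → Set
      Rerouted w v = ∃[ t ] (t ∈ᵥ B × t ≢ w × Reach D (remove U w) v t)

      via-a : ∀ {w v} → w ≢ a → Reach D (remove U w) b v → Rerouted w v
      via-a w≢a b⇝v = a , a∈B , ≢-sym w≢a ,
        reach-trans (reach-sym b⇝v)
          (reach-adjacent (reach-source b⇝v) (∈-remove⁺ U (∨-introˡ a∈B) (≢-sym w≢a)) b~a)

      via-q : ∀ {w v} → w ≢ q → Reach D (remove U w) v p → Rerouted w v
      via-q w≢q v⇝p = q , q∈B , ≢-sym w≢q ,
        reach-trans v⇝p
          (reach-adjacent (reach-target v⇝p) (∈-remove⁺ U (∨-introˡ q∈B) (≢-sym w≢q)) p~q)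

      reroute-on-ear : ∀ w v → v ∈ p ∷ zs → v ≢ w → Dec (w ∈ p ∷ zs) → Rerouted w v
      reroute-on-ear w v v∈ v≢w (yes w∈)
        with path-split P (λ z∈ z≢w → ∈-remove⁺ U (on-ear z∈) z≢w) w∈ v∈ v≢w
      ... | inj₁ v⇝p = via-q (off-ear q∈B w∈) v⇝p
      ... | inj₂ b⇝v = via-a (off-ear a∈B w∈) b⇝v
      reroute-on-ear w v v∈ v≢w (no w∉)
        with path-reach P (All.tabulate (λ z∈ → ∈-remove⁺ U (on-ear z∈) (λ { refl → w∉ z∈ }))) v∈
      ... | v⇝p , b⇝v with q ≟ w
      ...   | yes refl = via-a q≢a b⇝v
      ...   | no q≢w   = via-q (≢-sym q≢w) v⇝p

      reroute : ∀ w v → v ∈ᵥ U → B v ≡ false → v ≢ w → Rerouted w v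
      reroute w v v∈U v∉B v≢w with ∨-elim v∈U
      ... | inj₁ v∈B = ⊥-elim (true≢false (trans (sym v∈B) v∉B))
      ... | inj₂ v∈L = reroute-on-ear w v (does⇒ (v ∈? p ∷ zs) v∈L) v≢w (w ∈? p ∷ zs)

  -- A neighbour b ∉ B joined back to B inside D - a would give an ear of B, contradicting maximality.
  neighbours-in-block : ∀ {B a b} → IsBlock D full B → a ∈ᵥ B → ¬ CutVertex D full a →
    B b ≡ false → adjacent D a b ≡ false
  neighbours-in-block {B} {a} {b} (_ , bicB , maximal) a∈B a-not-cut b∉B with adjacent D a b in a~b
  ... | false = refl
  ... | true  = ⊥-elim (a-not-cut (refl , no-detour))
    where
      no-detour : ¬ Connected D (remove full a)
      no-detour conn with other-vertex bicB a
      ... | y , y∈B , a≢y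
        with simple-path (conn b y
               (∈-remove⁺ full {v = b} refl (λ { refl → true≢false (trans (sym a∈B) b∉B) }))
               (∈-remove⁺ full {v = y} refl (≢-sym a≢y)))
      ... | ws , P , avoids-a with first-entry B P b∉B (here y∈B)
      ... | q , p , zs , Q , p~q , q∈B , q∈ , outside =
        true≢false (trans (sym (maximal _ (λ _ → ∨-introˡ) (λ _ _ → refl) ear p p∈ear))
                          (All.lookup outside (here refl)))
        where
          ear : Biconnected D (B ∪ᵥ listSet (p ∷ zs))
          ear = ear-biconnected bicB a∈B q∈B (∈-remove-≢ full (All.lookup avoids-a q∈)) Q
                                (adjacent-sym a~b) p~q outside
          p∈ear : p ∈ᵥ (B ∪ᵥ listSet (p ∷ zs))
          p∈ear = ∨-introʳ {a = B p} (dec-true (p ∈? p ∷ zs) (here refl))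

-- Cycles and complete digraphs are biconnected

module HamiltonianCycle {n : ℕ} (D : Digraph n) (S : VSet n) {m : ℕ}
  (c : Fin (suc (suc m)) → Fin n)
  (c-injective : ∀ i j → c i ≡ c j → i ≡ j)
  (c-∈ : ∀ i → c i ∈ᵥ S)
  (c-onto : ∀ v → v ∈ᵥ S → ∃[ i ] c i ≡ v)
  (c-next : ∀ i j → toℕ j ≡ suc (toℕ i) % suc (suc m) → arc D (c i) (c j) ≡ true)
  where
  open Reachability D

  len : ℕ
  len = suc (suc m)

  at : ∀ i → i < len → Fin n
  at i i<len = c (fromℕ< i<len)

  last<len : suc m < len
  last<len = ℕ.n<1+n (suc m)

  0<len : 0 < len
  0<len = s≤s z≤n

  at-injective : ∀ {i j} (p : i < len) (q : j < len) → at i p ≡ at j q → i ≡ j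
  at-injective p q e =
    trans (sym (toℕ-fromℕ< p)) (trans (cong toℕ (c-injective _ _ e)) (toℕ-fromℕ< q))

  at-cong : ∀ {i j} → i ≡ j → (p : i < len) (q : j < len) → at i p ≡ at j q
  at-cong refl p q = refl

  at-onto : ∀ v → v ∈ᵥ S → Σ[ i ∈ ℕ ] Σ[ p ∈ i < len ] at i p ≡ v
  at-onto v v∈S with c-onto v v∈S
  ... | i , ci≡v = toℕ i , toℕ<n i , trans (cong c (fromℕ<-toℕ i (toℕ<n i))) ci≡v

  next-adjacent : ∀ i (p : i < len) (q : suc i < len) → adjacent D (at i p) (at (suc i) q) ≡ true
  next-adjacent i p q = arc⇒adjacent (c-next _ _ (begin
    toℕ (fromℕ< q)            ≡⟨ toℕ-fromℕ< q ⟩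
    suc i                     ≡⟨ m<n⇒m%n≡m q ⟨
    suc i % len               ≡⟨ cong (λ j → suc j % len) (toℕ-fromℕ< p) ⟨
    suc (toℕ (fromℕ< p)) % len ∎))
    where open ≡-Reasoning

  wrap-adjacent : adjacent D (at (suc m) last<len) (at 0 0<len) ≡ true
  wrap-adjacent = arc⇒adjacent (c-next _ _ (begin
    toℕ (fromℕ< 0<len)                 ≡⟨ toℕ-fromℕ< 0<len ⟩
    0                                  ≡⟨ n%n≡0 len ⟨
    len % len                          ≡⟨ cong (λ j → suc j % len) (toℕ-fromℕ< last<len) ⟨
    suc (toℕ (fromℕ< last<len)) % len ∎))
    where open ≡-Reasoning

  segment : ∀ (X : VSet n) i j → i ≤ j → (p : i < len) (q : j < len) →
    (∀ k (r : k < len) → i ≤ k → k ≤ j → at k r ∈ᵥ X) → Reach D X (at i p) (at j q)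
  segment X i zero    z≤n p q inX = here (inX 0 q z≤n z≤n)
  segment X i (suc j) i≤j p q inX with ℕ.m≤n⇒m<n∨m≡n i≤j
  ... | inj₂ refl      = here (inX _ q i≤j ℕ.≤-refl)
  ... | inj₁ (s≤s i≤j') =
    step (segment X i j i≤j' p j<len (λ k r i≤k k≤j → inX k r i≤k (ℕ.m≤n⇒m≤1+n k≤j)))
         (next-adjacent j j<len q) (inX _ q i≤j ℕ.≤-refl)
    where
      j<len : j < len
      j<len = ℕ.<-trans (ℕ.n<1+n j) q

  from-first : ∀ i (p : i < len) → Reach D S (at 0 0<len) (at i p)
  from-first i p = segment S 0 i z≤n 0<len p (λ k r _ _ → c-∈ _)

  connected : Connected D S
  connected a b a∈ b∈ with at-onto a a∈ | at-onto b b∈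
  ... | i , p , refl | j , q , refl = reach-trans (reach-sym (from-first i p)) (from-first j q)

  ≤last : ∀ {k} → k < len → k ≤ suc m
  ≤last (s≤s k≤) = k≤

  module Without (t : ℕ) (pt : t < len) where

    X : VSet n
    X = remove S (at t pt)

    kept : ∀ k (r : k < len) → k ≢ t → at k r ∈ᵥ X
    kept k r k≢t = ∈-remove⁺ S (c-∈ _) (λ e → k≢t (at-injective r pt e))

    -- The arc from the last vertex to the first joins the two segments left by deleting at t.
    common-target : Σ[ h ∈ Fin n ] (∀ k (r : k < len) → k ≢ t → Reach D X (at k r) h)
    common-target with t ℕ.≟ 0
    ... | yes refl = at (suc m) last<len , λ k r k≢0 →
      segment X k (suc m) (≤last r) r last<len
        (λ j rj k≤j _ → kept j rj (λ { refl → k≢0 (ℕ.n≤0⇒n≡0 k≤j) }))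
    ... | no t≢0 = at 0 0<len , to-first
      where
        to-first : ∀ k (r : k < len) → k ≢ t → Reach D X (at k r) (at 0 0<len)
        to-first k r k≢t with ℕ.<-cmp k t
        ... | tri< k<t _ _ = reach-sym (segment X 0 k z≤n 0<len r
                (λ j rj _ j≤k → kept j rj (ℕ.<⇒≢ (ℕ.≤-<-trans j≤k k<t))))
        ... | tri≈ _ k≡t _ = ⊥-elim (k≢t k≡t)
        ... | tri> _ _ t<k =
          step (segment X k (suc m) (≤last r) r last<len
                  (λ j rj k≤j _ → kept j rj (≢-sym (ℕ.<⇒≢ (ℕ.<-≤-trans t<k k≤j)))))
               wrap-adjacent (kept 0 0<len (≢-sym t≢0))

    to-common-target : ∀ {v} → v ∈ᵥ X → Reach D X v (proj₁ common-target)
    to-common-target {v} v∈ with at-onto v (∈-remove⁻ S v∈)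
    ... | k , r , refl = proj₂ common-target k r (λ { refl → ∈-remove-≢ S v∈ (at-cong refl r pt) })

  connected-without : ∀ w → w ∈ᵥ S → Connected D (remove S w)
  connected-without w w∈ with at-onto w w∈
  ... | t , pt , refl = λ a b a∈ b∈ → reach-trans (to-common-target a∈) (reach-sym (to-common-target b∈))
    where open Without t pt

  biconnected : Biconnected D S
  biconnected =
    (at 0 0<len , at 1 1<len , c-∈ _ , c-∈ _ , λ e → 0≢1 (at-injective 0<len 1<len e)) ,
    connected , connected-without
    where
      1<len : 1 < len
      1<len = s≤s (s≤s z≤n)
      0≢1 : 0 ≢ 1
      0≢1 ()

module Shapes {n : ℕ} (D : Digraph n) where
  open Reachability D

  oddCycle-biconnected : ∀ {S} → BidirectedOddCycle D S → Biconnected D S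
  oddCycle-biconnected {S} (_ , c , c-injective , c-∈ , c-onto , arcs) =
    HamiltonianCycle.biconnected D S c c-injective c-∈ c-onto (λ i j e → Equivalence.from (arcs i j) (inj₁ e))

  complete-connected : ∀ {S} → BidirectedComplete D S → Connected D S
  complete-connected K a b a∈ b∈ with a ≟ b
  ... | yes refl = here a∈
  ... | no a≢b   = reach-adjacent a∈ b∈ (arc⇒adjacent (K a b a∈ b∈ a≢b))

  complete-biconnected : ∀ {S} → BidirectedComplete D S →
    Σ[ u ∈ Fin n ] Σ[ v ∈ Fin n ] (u ∈ᵥ S × v ∈ᵥ S × u ≢ v) → Biconnected D S
  complete-biconnected {S} K two = two , complete-connected K , λ w _ →
    complete-connected (λ a b a∈ b∈ → K a b (∈-remove⁻ S a∈) (∈-remove⁻ S b∈))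

module Degrees {n : ℕ} (D : Digraph n) where
  open Reachability D

  deg-cong : ∀ {S T} → (∀ v → S v ≡ T v) → ∀ v → deg D S v ≡ deg D T v
  deg-cong S≗T v = cong₂ _,_ (count-cong (λ u → cong (_∧ arc D u v) (S≗T u)))
                             (count-cong (λ u → cong (_∧ arc D v u) (S≗T u)))

  biconnected-deg≢𝟘 : ∀ {B u} → Biconnected D B → u ∈ᵥ B → deg D B u ≢ 𝟘
  biconnected-deg≢𝟘 {B} {u} bicB u∈B deg≡𝟘 with other-vertex bicB u
  ... | w , w∈B , u≢w with reach-neighbour (proj₁ (proj₂ bicB) u w u∈B w∈B) u≢w
  ...   | w' , w'∈B , u~w' with arc D u w' in u→w'
  ...     | true  = count≢0 w' (cong₂ _∧_ w'∈B u→w') (cong proj₂ deg≡𝟘)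
  ...     | false = count≢0 w' (cong₂ _∧_ w'∈B u~w') (cong proj₁ deg≡𝟘)

  complete-deg : ∀ {B v} → BidirectedComplete D B → v ∈ᵥ B → deg D B v ≡ (count B ∸ 1 , count B ∸ 1)
  complete-deg {B} {v} K v∈B = cong₂ _,_ (trans (count-cong into) size) (trans (count-cong out) size)
    where
      size : count (remove B v) ≡ count B ∸ 1
      size = sym (cong (_∸ 1) (count-remove B v v∈B))
      into : ∀ w → (B w ∧ arc D w v) ≡ remove B v w
      into w with B w in Bw
      ... | false = refl
      ... | true with w ≟ v
      ...   | yes refl = loopless D w
      ...   | no  w≢v  = K w v Bw v∈B w≢v
      out : ∀ w → (B w ∧ arc D v w) ≡ remove B v w
      out w with B w in Bw
      ... | false = refl
      ... | true with w ≟ v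
      ...   | yes refl = loopless D w
      ...   | no  w≢v  = K v w v∈B Bw (≢-sym w≢v)

  outdeg-within : ∀ {B u} → (∀ w → B w ≡ false → arc D u w ≡ false) → outdeg D full u ≡ outdeg D B u
  outdeg-within {B} {u} local = count-cong pointwise
    where
      pointwise : ∀ w → arc D u w ≡ (B w ∧ arc D u w)
      pointwise w with B w in Bw
      ... | true  = refl
      ... | false = local w Bw

-- The data of a type (iv) decomposition of S at y, split into its set and its colouring part.
record Split {n} (D : Digraph n) (S S₁ S₂ : VSet n) (y : Fin n) : Set where
  constructor mkSplit
  field
    y∈₁   : y ∈ᵥ S₁
    y∈₂   : y ∈ᵥ S₂
    S≡∪   : ∀ v → S v ≡ (S₁ ∪ᵥ S₂) v
    meet  : ∀ v → v ∈ᵥ S₁ → v ∈ᵥ S₂ → v ≡ y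
    apart : ∀ u v → u ∈ᵥ S₁ → v ∈ᵥ S₂ → u ≢ y → v ≢ y →
            (arc D u v ≡ false) × (arc D v u ≡ false)

record ColourSplit {n s} (S₁ S₂ : VSet n) (y : Fin n) (F F₁ F₂ : Col s n) : Set where
  constructor mkColourSplit
  field
    on₁  : ∀ k v → v ∈ᵥ S₁ → v ≢ y → F k v ≡ F₁ k v
    on₂  : ∀ k v → v ∈ᵥ S₂ → v ≢ y → F k v ≡ F₂ k v
    at-y : ∀ k → F k y ≡ F₁ k y +² F₂ k y

module HardPairs {n : ℕ} (D : Digraph n) where
  open Reachability D
  open Blocks D using (remove-connected)
  open Shapes D

  private variable
    s : ℕ
    S S₁ S₂ B : VSet n
    F F₁ F₂ : Col s n
    y : Fin n

  split-swap : Split D S S₁ S₂ y → Split D S S₂ S₁ y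
  split-swap {S₁ = S₁} {S₂ = S₂} (mkSplit y∈₁ y∈₂ S≡∪ meet apart) =
    mkSplit y∈₂ y∈₁ (λ v → trans (S≡∪ v) (∨-comm (S₁ v) (S₂ v)))
            (λ v v∈₂ v∈₁ → meet v v∈₁ v∈₂)
            (λ u v u∈₂ v∈₁ u≢y v≢y → swap (apart v u v∈₁ u∈₂ v≢y u≢y))

  colour-swap : ColourSplit S₁ S₂ y F F₁ F₂ → ColourSplit S₂ S₁ y F F₂ F₁
  colour-swap {y = y} {F₁ = F₁} {F₂ = F₂} (mkColourSplit on₁ on₂ at-y) =
    mkColourSplit on₂ on₁ (λ k → trans (at-y k) (+²-comm (F₁ k y) (F₂ k y)))

  glue′ : Split D S S₁ S₂ y → ColourSplit S₁ S₂ y F F₁ F₂ →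
          Hard D S₁ F₁ → Hard D S₂ F₂ → Hard D S F
  glue′ {y = y} (mkSplit y∈₁ y∈₂ S≡∪ meet apart) (mkColourSplit on₁ on₂ at-y) =
    glue y _ _ _ _ y∈₁ y∈₂ S≡∪ meet apart on₁ on₂ at-y

  ⊆-side₁ : Split D S S₁ S₂ y → S₁ ⊆ᵥ S
  ⊆-side₁ σ v v∈₁ = trans (Split.S≡∪ σ v) (∨-introˡ v∈₁)

  ⊆-side₂ : Split D S S₁ S₂ y → S₂ ⊆ᵥ S
  ⊆-side₂ σ = ⊆-side₁ (split-swap σ)

  side : Split D S S₁ S₂ y → ∀ {v} → v ∈ᵥ S → v ∈ᵥ S₁ ⊎ v ∈ᵥ S₂
  side σ {v} v∈ = ∨-elim (trans (sym (Split.S≡∪ σ v)) v∈)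

  Hard⇒Connected : Hard D S F → Connected D S
  Hard⇒Connected (mono bic _ _)        = proj₁ (proj₂ bic)
  Hard⇒Connected (cycle cyc _ _ _ _)   = proj₁ (proj₂ (oddCycle-biconnected cyc))
  Hard⇒Connected (complete K _ _ _)    = complete-connected K
  Hard⇒Connected {S = S} (glue y S₁ S₂ _ _ y∈₁ y∈₂ S≡∪ meet apart _ _ _ h₁ h₂) a b a∈ b∈ =
    reach-trans (to-y a∈) (reach-sym (to-y b∈))
    where
      σ : Split D S S₁ S₂ y
      σ = mkSplit y∈₁ y∈₂ S≡∪ meet apart
      to-y : ∀ {v} → v ∈ᵥ S → Reach D S v y
      to-y v∈ with side σ v∈
      ... | inj₁ v∈₁ = reach-mono (⊆-side₁ σ) (Hard⇒Connected h₁ _ y v∈₁ y∈₁)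
      ... | inj₂ v∈₂ = reach-mono (⊆-side₂ σ) (Hard⇒Connected h₂ _ y v∈₂ y∈₂)

  biconnected-not-subsingleton : Biconnected D S → ∀ y → ¬ (∀ v → v ∈ᵥ S → v ≡ y)
  biconnected-not-subsingleton ((u , v , u∈ , v∈ , u≢v) , _) y only-y =
    u≢v (trans (only-y u u∈) (sym (only-y v v∈)))

  Hard-subsingleton-zero : Hard D S F → ∀ y → (∀ v → v ∈ᵥ S → v ≡ y) → y ∈ᵥ S →
    ∀ k → F k y ≡ 𝟘
  Hard-subsingleton-zero (mono bic _ _) y only-y _ _ =
    ⊥-elim (biconnected-not-subsingleton bic y only-y)
  Hard-subsingleton-zero (cycle cyc _ _ _ _) y only-y _ _ =
    ⊥-elim (biconnected-not-subsingleton (oddCycle-biconnected cyc) y only-y)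
  Hard-subsingleton-zero {F = F} (complete _ _ symmetric out-sum) y only-y y∈ k =
    cong₂ _,_ (trans (symmetric k y y∈) out≡0) out≡0
    where
      out≡0 : proj₂ (F k y) ≡ 0
      out≡0 = sumFin≡0⇒ (trans (out-sum y y∈) (count-subsingleton y only-y)) k
  Hard-subsingleton-zero {S = S} {F = F}
    (glue z S₁ S₂ F₁ F₂ z∈₁ z∈₂ S≡∪ meet apart _ _ at-z h₁ h₂) y only-y _ k =
    subst (λ w → F k w ≡ 𝟘) z≡y (begin
      F k z              ≡⟨ at-z k ⟩
      F₁ k z +² F₂ k z   ≡⟨ cong₂ _+²_
                              (Hard-subsingleton-zero h₁ z (λ v v∈ → only-z v (⊆-side₁ σ v v∈)) z∈₁ k)
                              (Hard-subsingleton-zero h₂ z (λ v v∈ → only-z v (⊆-side₂ σ v v∈)) z∈₂ k) ⟩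
      𝟘                  ∎)
    where
      σ : Split D S S₁ S₂ z
      σ = mkSplit z∈₁ z∈₂ S≡∪ meet apart
      z≡y : z ≡ y
      z≡y = only-y z (⊆-side₁ σ z z∈₁)
      only-z : ∀ v → v ∈ᵥ S → v ≡ z
      only-z v v∈ = trans (only-y v v∈) (sym z≡y)
      open ≡-Reasoning

  Hard-subsingleton : ∀ y → (∀ v → v ∈ᵥ S → v ≡ y) → (∀ k → F k y ≡ 𝟘) → Hard D S F
  Hard-subsingleton {F = F} y only-y F≡𝟘 = complete
    (λ u v u∈ v∈ u≢v → ⊥-elim (u≢v (trans (only-y u u∈) (sym (only-y v v∈)))))
    (λ k u v u∈ v∈ → cong (F k) (trans (only-y u u∈) (sym (only-y v v∈))))
    (λ k v v∈ → symmetric k (only-y v v∈))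
    (λ v v∈ → trans (out≡0 (only-y v v∈)) (sym (count-subsingleton y only-y)))
    where
      symmetric : ∀ k {v} → v ≡ y → proj₁ (F k v) ≡ proj₂ (F k v)
      symmetric k refl = trans (cong proj₁ (F≡𝟘 k)) (sym (cong proj₂ (F≡𝟘 k)))
      out≡0 : ∀ {v} → v ≡ y → sumFin (λ k → proj₂ (F k v)) ≡ 0
      out≡0 refl = sumFin-zero (λ k → cong proj₂ (F≡𝟘 k))

  Hard-resp-≗ : ∀ {T} z → z ∈ᵥ T → (∀ v → S v ≡ T v) → Hard D T F → Hard D S F
  Hard-resp-≗ {S = S} {F = F} {T = T} z z∈T S≗T h = glue′
    (mkSplit z∈T (dec-true (z ≟ z) refl) S≡ (λ v _ v≡z → does⇒ (v ≟ z) v≡z)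
             (λ _ v _ v≡z _ v≢z → ⊥-elim (v≢z (does⇒ (v ≟ z) v≡z))))
    (mkColourSplit (λ _ _ _ _ → refl) (λ _ v v≡z v≢z → ⊥-elim (v≢z (does⇒ (v ≟ z) v≡z)))
                   (λ k → sym (+²-identityʳ (F k z))))
    h (Hard-subsingleton z (λ v v≡z → does⇒ (v ≟ z) v≡z) (λ _ → refl))
    where
      S≡ : ∀ v → S v ≡ (T v ∨ does (v ≟ z))
      S≡ v with v ≟ z
      ... | yes refl = trans (S≗T v) (trans z∈T (sym (∨-zeroʳ (T v))))
      ... | no _     = trans (S≗T v) (sym (∨-identityʳ (T v)))

  biconnected-stays : Split D S S₁ S₂ y → Biconnected D B → B ⊆ᵥ S →
    ∀ b → b ∈ᵥ B → b ≢ y → b ∈ᵥ S₁ → B ⊆ᵥ S₁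
  biconnected-stays {S₁ = S₁} {y = y} {B = B} σ bicB B⊆S b b∈B b≢y b∈₁ v v∈B with v ≟ y
  ... | yes refl = Split.y∈₁ σ
  ... | no v≢y   = reach-closed S₁ b⇝v b∈₁ closed
    where
      b⇝v : Reach D (remove B y) b v
      b⇝v = remove-connected bicB y b v (∈-remove⁺ B b∈B b≢y) (∈-remove⁺ B v∈B v≢y)
      closed : ∀ w w' → w ∈ᵥ remove B y → w' ∈ᵥ remove B y → w ∈ᵥ S₁ →
               adjacent D w w' ≡ true → w' ∈ᵥ S₁
      closed w w' w∈ w'∈ w∈₁ w~w' with side σ (B⊆S w' (∈-remove⁻ B w'∈))
      ... | inj₁ w'∈₁ = w'∈₁
      ... | inj₂ w'∈₂ with Split.apart σ w w' w∈₁ w'∈₂ (∈-remove-≢ B w∈) (∈-remove-≢ B w'∈)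
      ...   | w↛w' , w'↛w = ⊥-elim (true≢false (trans (sym w~w') (cong₂ _∨_ w↛w' w'↛w)))

  biconnected-on-side : Split D S S₁ S₂ y → Biconnected D B → B ⊆ᵥ S → B ⊆ᵥ S₁ ⊎ B ⊆ᵥ S₂
  biconnected-on-side {y = y} σ bicB B⊆S with other-vertex bicB y
  ... | b , b∈B , y≢b with side σ (B⊆S b b∈B)
  ...   | inj₁ b∈₁ = inj₁ (biconnected-stays σ bicB B⊆S b b∈B (≢-sym y≢b) b∈₁)
  ...   | inj₂ b∈₂ = inj₂ (biconnected-stays (split-swap σ) bicB B⊆S b b∈B (≢-sym y≢b) b∈₂)

-- Peeling an end-block off a hard pair

module Peeling {n : ℕ} (D : Digraph n) (B : VSet n) (x : Fin n)
  (bicB : Biconnected D B)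
  (maximal : ∀ T → B ⊆ᵥ T → T ⊆ᵥ full → Biconnected D T → T ⊆ᵥ B)
  (x∈B : x ∈ᵥ B)
  (sealed : ∀ {a b} → a ∈ᵥ B → a ≢ x → B b ≡ false → adjacent D a b ≡ false)
  where
  open Reachability D
  open Shapes D
  open Degrees D using (deg-cong)
  open HardPairs D

  rest : VSet n → VSet n
  rest S v = S v ∧ contractSet B x v

  x∈contract : x ∈ᵥ contractSet B x
  x∈contract = trans (cong (not (B x) ∨_) (dec-true (x ≟ x) refl)) (∨-zeroʳ (not (B x)))

  x∈rest : ∀ {S} → x ∈ᵥ S → x ∈ᵥ rest S
  x∈rest x∈S = cong₂ _∧_ x∈S x∈contract

  rest-mono : ∀ {S T} → S ⊆ᵥ T → rest S ⊆ᵥ rest T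
  rest-mono S⊆T v v∈ = cong₂ _∧_ (S⊆T v (∧-conicalˡ _ _ v∈)) (∧-conicalʳ _ _ v∈)

  rest-⊆-x : ∀ {S} → S ⊆ᵥ B → ∀ v → v ∈ᵥ rest S → v ≡ x
  rest-⊆-x {S} S⊆B v v∈ with S v in Sv
  ... | true rewrite S⊆B v Sv = does⇒ (v ≟ x) v∈

  data BlockPattern {s} (P : Col s n) : Set where
    monochromatic : (i : Fin s) →
      (∀ v → v ∈ᵥ B → (P i v ≡ deg D B v) × (∀ k → k ≢ i → P k v ≡ 𝟘)) → BlockPattern P
    bicycle : (i j : Fin s) → i ≢ j →
      (∀ v → v ∈ᵥ B → (P i v ≡ 𝟙) × (P j v ≡ 𝟙) × (∀ k → k ≢ i → k ≢ j → P k v ≡ 𝟘)) →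
      BlockPattern P
    constant : BidirectedComplete D B → (∀ k u v → u ∈ᵥ B → v ∈ᵥ B → P k u ≡ P k v) → BlockPattern P

  -- part is the base piece on B of a derivation of the hard pair (S, G) with B ⊆ S; deleting
  -- B - x and lowering the demand at x by part leaves a hard pair on the rest of S.
  record Peeled {s} (S : VSet n) (G : Col s n) : Set where
    field
      part       : Col s n
      is-pattern : BlockPattern part
      agrees     : ∀ k v → v ∈ᵥ B → v ≢ x → part k v ≡ G k v
      below      : ∀ k → part k x ≤² G k x
      rest-hard  : ∀ (G' : Col s n) → (∀ k v → v ∈ᵥ rest S → v ≢ x → G' k v ≡ G k v) →
                   (∀ k → G' k x ≡ G k x ∸² part k x) → Hard D (rest S) G'

  peel-block : ∀ {s S} {G : Col s n} → B ⊆ᵥ S → Biconnected D S →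
    ((∀ v → S v ≡ B v) → BlockPattern G) → Peeled S G
  peel-block {S = S} {G} B⊆S bicS pattern-of = record
    { part       = G
    ; is-pattern = pattern-of (⊆-antisym S⊆B B⊆S)
    ; agrees     = λ _ _ _ _ → refl
    ; below      = λ _ → ≤²-refl
    ; rest-hard  = λ G' _ G'-x → Hard-subsingleton x (rest-⊆-x S⊆B) (λ k → trans (G'-x k) (∸²-self (G k x)))
    }
    where
      S⊆B : S ⊆ᵥ B
      S⊆B = maximal S B⊆S (λ _ _ → refl) bicS

  module Glue {s} {S S₁ S₂ : VSet n} {G G₁ G₂ : Col s n} {y : Fin n}
    (σ : Split D S S₁ S₂ y) (κ : ColourSplit S₁ S₂ y G G₁ G₂)
    (peeled₁ : Peeled S₁ G₁) (hard₂ : Hard D S₂ G₂) (B⊆S₁ : B ⊆ᵥ S₁)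
    where
    open Split σ
    open ColourSplit κ
    open Peeled peeled₁

    x∈S₁ : x ∈ᵥ S₁
    x∈S₁ = B⊆S₁ x x∈B

    -- When the glue vertex lies in B - x, the other side is just that vertex.
    module Interior (y∈B : y ∈ᵥ B) (y≢x : y ≢ x) where

      S₂-trivial : ∀ v → v ∈ᵥ S₂ → v ≡ y
      S₂-trivial v v∈₂ with v ≟ y
      ... | yes v≡y = v≡y
      ... | no  v≢y with reach-neighbour (Hard⇒Connected hard₂ y v y∈₂ v∈₂) (≢-sym v≢y)
      ...   | w , w∈₂ , y~w = ⊥-elim (true≢false (trans (sym y~w) (sealed y∈B y≢x w∉B)))
        where
          w∉B : B w ≡ false
          w∉B = ¬-not λ w∈B → true≢false (trans (sym y~w)
                  (subst (λ z → adjacent D y z ≡ false) (sym (meet w (B⊆S₁ w w∈B) w∈₂)) (adjacent-irrefl y)))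

      G≡G₁ : ∀ k v → v ∈ᵥ S₁ → G k v ≡ G₁ k v
      G≡G₁ k v v∈₁ with v ≟ y
      ... | yes refl = begin
        G k y              ≡⟨ at-y k ⟩
        G₁ k y +² G₂ k y   ≡⟨ cong (G₁ k y +²_) (Hard-subsingleton-zero hard₂ y S₂-trivial y∈₂ k) ⟩
        G₁ k y +² 𝟘        ≡⟨ +²-identityʳ (G₁ k y) ⟩
        G₁ k y             ∎
        where open ≡-Reasoning
      ... | no v≢y = on₁ k v v∈₁ v≢y

      y∉contract : contractSet B x y ≡ false
      y∉contract = cong₂ _∨_ (cong not y∈B) (dec-false (y ≟ x) y≢x)

      rest≗ : ∀ v → rest S v ≡ rest S₁ v
      rest≗ v with v ≟ y
      ... | yes refl = begin
        S y ∧ contractSet B x y    ≡⟨ cong (S y ∧_) y∉contract ⟩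
        S y ∧ false                ≡⟨ ∧-zeroʳ (S y) ⟩
        false                      ≡⟨ ∧-zeroʳ (S₁ y) ⟨
        S₁ y ∧ false               ≡⟨ cong (S₁ y ∧_) y∉contract ⟨
        S₁ y ∧ contractSet B x y   ∎
        where open ≡-Reasoning
      ... | no v≢y = cong (_∧ contractSet B x v) (begin
        S v           ≡⟨ S≡∪ v ⟩
        S₁ v ∨ S₂ v   ≡⟨ cong (S₁ v ∨_) (¬-not (λ v∈₂ → v≢y (S₂-trivial v v∈₂))) ⟩
        S₁ v ∨ false  ≡⟨ ∨-identityʳ (S₁ v) ⟩
        S₁ v          ∎)
        where open ≡-Reasoning

      peeled : Peeled S G
      peeled = record
        { part       = part
        ; is-pattern = is-pattern
        ; agrees     = λ k v v∈B v≢x → trans (agrees k v v∈B v≢x) (sym (G≡G₁ k v (B⊆S₁ v v∈B)))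
        ; below      = λ k → subst (part k x ≤²_) (sym (G≡G₁ k x x∈S₁)) (below k)
        ; rest-hard  = λ G' agree G'-x → Hard-resp-≗ x (x∈rest {S₁} x∈S₁) rest≗ (rest-hard G'
            (λ k v v∈ v≢x → trans (agree k v (trans (rest≗ v) v∈) v≢x) (G≡G₁ k v (∧-conicalˡ _ _ v∈)))
            (λ k → trans (G'-x k) (cong (_∸² part k x) (G≡G₁ k x x∈S₁))))
        }

    -- Otherwise the glue survives the contraction, with the x-value of the first side lowered.
    module Outside (y-outside : B y ≡ false ⊎ y ≡ x) where

      y∈contract : y ∈ᵥ contractSet B x
      y∈contract = [ (λ y∉B → cong (λ b → not b ∨ does (y ≟ x)) y∉B)
                   , (λ y≡x → subst (_∈ᵥ contractSet B x) (sym y≡x) x∈contract) ]′ y-outside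

      S₂⊆contract : S₂ ⊆ᵥ contractSet B x
      S₂⊆contract v v∈₂ with v ≟ y
      ... | yes refl = y∈contract
      ... | no v≢y with B v in Bv
      ...   | true  = ⊥-elim (v≢y (meet v (B⊆S₁ v Bv) v∈₂))
      ...   | false = refl

      interior≢y : ∀ {v} → v ∈ᵥ B → v ≢ x → v ≢ y
      interior≢y v∈B v≢x v≡y =
        [ (λ y∉B → true≢false (trans (sym v∈B) (trans (cong B v≡y) y∉B)))
        , (λ y≡x → v≢x (trans v≡y y≡x)) ]′ y-outside

      G-at-x : ∀ k → x ≡ y → G k x ≡ G₁ k x +² G₂ k x
      G-at-x k x≡y = subst (λ z → G k z ≡ G₁ k z +² G₂ k z) (sym x≡y) (at-y k)

      below-G : ∀ k → part k x ≤² G k x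
      below-G k with x ≟ y
      ... | yes x≡y = subst (part k x ≤²_) (sym (G-at-x k x≡y))
                            (≤²-trans (below k) (≤²-+ (G₁ k x) (G₂ k x)))
      ... | no  x≢y = subst (part k x ≤²_) (sym (on₁ k x x∈S₁ x≢y)) (below k)

      G₁↓ : Col s n
      G₁↓ = update G₁ x (λ k → G₁ k x ∸² part k x)

      rest-split : Split D (rest S) (rest S₁) S₂ y
      rest-split = mkSplit (cong₂ _∧_ y∈₁ y∈contract) y∈₂
        (λ v → trans (cong (_∧ contractSet B x v) (S≡∪ v))
                     (∨-∧-absorbʳ (S₁ v) (S₂ v) _ (S₂⊆contract v)))
        (λ v v∈ → meet v (∧-conicalˡ _ _ v∈))
        (λ u v u∈ → apart u v (∧-conicalˡ _ _ u∈))

      module _ (G' : Col s n) (agree : ∀ k v → v ∈ᵥ rest S → v ≢ x → G' k v ≡ G k v)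
               (G'-x : ∀ k → G' k x ≡ G k x ∸² part k x) where

        at-x : ∀ k → x ≢ y → G' k x ≡ G₁↓ k x
        at-x k x≢y = begin
          G' k x                ≡⟨ G'-x k ⟩
          G k x ∸² part k x     ≡⟨ cong (_∸² part k x) (on₁ k x x∈S₁ x≢y) ⟩
          G₁ k x ∸² part k x    ≡⟨ update-same G₁ x _ k ⟨
          G₁↓ k x               ∎
          where open ≡-Reasoning

        on-rest₁ : ∀ k v → v ∈ᵥ rest S₁ → v ≢ y → G' k v ≡ G₁↓ k v
        on-rest₁ k v v∈ v≢y = by-cases (v ≟ x)
          where
            by-cases : Dec (v ≡ x) → G' k v ≡ G₁↓ k v
            by-cases (yes v≡x) = subst (λ z → G' k z ≡ G₁↓ k z) (sym v≡x)
                                       (at-x k (λ x≡y → v≢y (trans v≡x x≡y)))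
            by-cases (no v≢x)  = trans (agree k v (rest-mono (⊆-side₁ σ) v v∈) v≢x)
                                   (trans (on₁ k v (∧-conicalˡ _ _ v∈) v≢y) (sym (update-other G₁ _ k v≢x)))

        on-S₂ : ∀ k v → v ∈ᵥ S₂ → v ≢ y → G' k v ≡ G₂ k v
        on-S₂ k v v∈₂ v≢y =
          trans (agree k v (cong₂ _∧_ (⊆-side₂ σ v v∈₂) (S₂⊆contract v v∈₂)) v≢x) (on₂ k v v∈₂ v≢y)
          where
            v≢x : v ≢ x
            v≢x refl = v≢y (meet x x∈S₁ v∈₂)

        at-glue : ∀ k → G' k y ≡ G₁↓ k y +² G₂ k y
        at-glue k = by-cases (y ≟ x)
          where
            open ≡-Reasoning
            by-cases : Dec (y ≡ x) → G' k y ≡ G₁↓ k y +² G₂ k y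
            by-cases (yes y≡x) = subst (λ z → G' k z ≡ G₁↓ k z +² G₂ k z) (sym y≡x) (begin
              G' k x                          ≡⟨ G'-x k ⟩
              G k x ∸² part k x               ≡⟨ cong (_∸² part k x) (G-at-x k (sym y≡x)) ⟩
              (G₁ k x +² G₂ k x) ∸² part k x  ≡⟨ +-∸²-comm (G₁ k x) (G₂ k x) (part k x) (below k) ⟩
              (G₁ k x ∸² part k x) +² G₂ k x  ≡⟨ cong (_+² G₂ k x) (update-same G₁ x _ k) ⟨
              G₁↓ k x +² G₂ k x               ∎)
            by-cases (no y≢x) = trans (agree k y (cong₂ _∧_ (⊆-side₁ σ y y∈₁) y∈contract) y≢x)
                                  (trans (at-y k) (cong (_+² G₂ k y) (sym (update-other G₁ _ k y≢x))))

        rest-S-hard : Hard D (rest S) G'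
        rest-S-hard = glue′ rest-split (mkColourSplit on-rest₁ on-S₂ at-glue)
          (rest-hard G₁↓ (λ k v _ v≢x → update-other G₁ _ k v≢x) (update-same G₁ x _)) hard₂

      peeled : Peeled S G
      peeled = record
        { part       = part
        ; is-pattern = is-pattern
        ; agrees     = λ k v v∈B v≢x →
            trans (agrees k v v∈B v≢x) (sym (on₁ k v (B⊆S₁ v v∈B) (interior≢y v∈B v≢x)))
        ; below      = below-G
        ; rest-hard  = rest-S-hard
        }

    peeled : Peeled S G
    peeled with B y in By | y ≟ x
    ... | false | _        = Outside.peeled (inj₁ By)
    ... | true  | yes y≡x  = Outside.peeled (inj₂ y≡x)
    ... | true  | no  y≢x  = Interior.peeled By y≢x

  mutual
    peel : ∀ {s S} {G : Col s n} → Hard D S G → B ⊆ᵥ S → Peeled S G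
    peel (mono bicS i h) B⊆S = peel-block B⊆S bicS λ S≗B → monochromatic i λ v v∈B →
      trans (proj₁ (h v (B⊆S v v∈B))) (deg-cong S≗B v) , proj₂ (h v (B⊆S v v∈B))
    peel (cycle cyc i j i≢j h) B⊆S =
      peel-block B⊆S (oddCycle-biconnected cyc) λ _ → bicycle i j i≢j λ v v∈B → h v (B⊆S v v∈B)
    peel {S = S} (complete K const _ _) B⊆S =
      peel-block B⊆S (complete-biconnected K two) λ _ →
        constant (λ u v u∈ v∈ → K u v (B⊆S u u∈) (B⊆S v v∈))
                 (λ k u v u∈ v∈ → const k u v (B⊆S u u∈) (B⊆S v v∈))
      where
        two : Σ[ u ∈ Fin n ] Σ[ v ∈ Fin n ] (u ∈ᵥ S × v ∈ᵥ S × u ≢ v)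
        two = let (u , v , u∈ , v∈ , u≢v) = proj₁ bicB in u , v , B⊆S u u∈ , B⊆S v v∈ , u≢v
    peel (glue y _ _ _ _ y∈₁ y∈₂ S≡∪ meet apart on₁ on₂ at-y h₁ h₂) B⊆S =
      peel-glue (mkSplit y∈₁ y∈₂ S≡∪ meet apart) (mkColourSplit on₁ on₂ at-y) h₁ h₂ B⊆S

    peel-glue : ∀ {s S S₁ S₂ y} {G G₁ G₂ : Col s n} → Split D S S₁ S₂ y →
      ColourSplit S₁ S₂ y G G₁ G₂ → Hard D S₁ G₁ → Hard D S₂ G₂ → B ⊆ᵥ S → Peeled S G
    peel-glue σ κ h₁ h₂ B⊆S with biconnected-on-side σ bicB B⊆S
    ... | inj₁ B⊆S₁ = Glue.peeled σ κ (peel h₁ B⊆S₁) h₂ B⊆S₁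
    ... | inj₂ B⊆S₂ = Glue.peeled (split-swap σ) (colour-swap κ) (peel h₂ B⊆S₂) h₁ B⊆S₂

bicycle-uniform : ∀ {s n} {P : Col s n} {i j} (Q : Fin n → Set) →
  (∀ v → Q v → (P i v ≡ 𝟙) × (P j v ≡ 𝟙) × (∀ k → k ≢ i → k ≢ j → P k v ≡ 𝟘)) →
  ∀ k {v w} → Q v → Q w → P k v ≡ P k w
bicycle-uniform {i = i} {j} Q on-Q k {v} {w} Qv Qw with k ≟ i
... | yes refl = trans (proj₁ (on-Q v Qv)) (sym (proj₁ (on-Q w Qw)))
... | no k≢i with k ≟ j
...   | yes refl = trans (proj₁ (proj₂ (on-Q v Qv))) (sym (proj₁ (proj₂ (on-Q w Qw))))
...   | no  k≢j  = trans (proj₂ (proj₂ (on-Q v Qv)) k k≢i k≢j) (sym (proj₂ (proj₂ (on-Q w Qw)) k k≢i k≢j))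

-- Contracting a hard end-block

module Contraction {n s : ℕ} (D : Digraph n) (F : Col s n) (B : VSet n) (x : Fin n)
  (end-block : EndBlockAt D full B x) (u : Fin n) (u∈B : u ∈ᵥ B) (u≢x : u ≢ x)
  (F' : Col s n) (contraction : IsContraction D B x u F F')
  where
  open Blocks D using (neighbours-in-block)
  open HardPairs D
  open Degrees D

  isBlock : IsBlock D full B
  isBlock = proj₁ end-block

  bicB : Biconnected D B
  bicB = proj₁ (proj₂ isBlock)

  x∈B : x ∈ᵥ B
  x∈B = proj₁ (proj₂ end-block)

  sealed : ∀ {a b} → a ∈ᵥ B → a ≢ x → B b ≡ false → adjacent D a b ≡ false
  sealed a∈B a≢x =
    neighbours-in-block isBlock a∈B (λ a-cut → a≢x (proj₂ (proj₂ (proj₂ end-block)) _ a∈B a-cut))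

  open Peeling D B x bicB (proj₂ (proj₂ isBlock)) x∈B sealed

  F'≡F : ∀ k v → v ≢ x → F' k v ≡ F k v
  F'≡F = proj₁ contraction

  F'-mono : MonoEB D F B x →
    ∀ k → (F k u ≢ 𝟘 → F' k x ≡ F k x ∸² deg D B x) × (F k u ≡ 𝟘 → F' k x ≡ F k x)
  F'-mono = proj₁ (proj₂ contraction)

  F'-not-mono : ¬ MonoEB D F B x → ∀ k → F' k x ≡ F k x ∸² F k u
  F'-not-mono = proj₂ (proj₂ contraction)

  𝟙≢𝟘 : 𝟙 ≢ 𝟘
  𝟙≢𝟘 ()

  two-colours⇒¬MonoEB : ∀ i j → i ≢ j → F i u ≡ 𝟙 → F j u ≡ 𝟙 → ¬ MonoEB D F B x
  two-colours⇒¬MonoEB i j i≢j Fiu Fju (c , _ , on-B) with i ≟ c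
  ... | yes refl = 𝟙≢𝟘 (trans (sym Fju) (proj₂ (on-B u u∈B u≢x) j (≢-sym i≢j)))
  ... | no  i≢c  = 𝟙≢𝟘 (trans (sym Fiu) (proj₂ (on-B u u∈B u≢x) i i≢c))

  -- MonoEB is undecidable, but the equation is decidable, so we may argue by contradiction.
  F'-x-via-u : ∀ k → (MonoEB D F B x → F' k x ≡ F k x ∸² F k u) → F' k x ≡ F k x ∸² F k u
  F'-x-via-u k if-mono with ≡-dec ℕ._≟_ ℕ._≟_ (F' k x) (F k x ∸² F k u)
  ... | yes eq = eq
  ... | no neq = ⊥-elim (neq (F'-not-mono (λ isMono → neq (if-mono isMono)) k))

  F'-x-complete : BidirectedComplete D B → ∀ k → F' k x ≡ F k x ∸² F k u
  F'-x-complete K k = F'-x-via-u k if-mono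
    where
      if-mono : MonoEB D F B x → F' k x ≡ F k x ∸² F k u
      if-mono isMono@(c , _ , on-B) with ≡-dec ℕ._≟_ ℕ._≟_ (F k u) 𝟘
      -- F k x ∸² 𝟘 reduces to F k x by η for pairs.
      ... | yes Fku≡𝟘 = trans (proj₂ (F'-mono isMono k) Fku≡𝟘) (cong (F k x ∸²_) (sym Fku≡𝟘))
      ... | no  Fku≢𝟘 with k ≟ c
      ...   | no  k≢c  = ⊥-elim (Fku≢𝟘 (proj₂ (on-B u u∈B u≢x) k k≢c))
      ...   | yes refl = trans (proj₁ (F'-mono isMono k) Fku≢𝟘) (cong (F k x ∸²_) (begin
        deg D B x                  ≡⟨ complete-deg K x∈B ⟩
        (count B ∸ 1 , count B ∸ 1) ≡⟨ complete-deg K u∈B ⟨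
        deg D B u                  ≡⟨ proj₁ (on-B u u∈B u≢x) ⟨
        F k u                      ∎))
        where open ≡-Reasoning

  module _ {P : Col s n} (agrees : ∀ k v → v ∈ᵥ B → v ≢ x → P k v ≡ F k v)
           (below : ∀ k → P k x ≤² F k x) where

    mono-pattern⇒MonoEB : ∀ i → (∀ v → v ∈ᵥ B → (P i v ≡ deg D B v) × (∀ k → k ≢ i → P k v ≡ 𝟘)) →
      MonoEB D F B x
    mono-pattern⇒MonoEB i on-B = i , subst (_≤² F i x) (proj₁ (on-B x x∈B)) (below i) , λ v v∈B v≢x →
      trans (sym (agrees i v v∈B v≢x)) (proj₁ (on-B v v∈B)) ,
      λ k k≢i → trans (sym (agrees k v v∈B v≢x)) (proj₂ (on-B v v∈B) k k≢i)

    F'-x-mono : ∀ i → (∀ v → v ∈ᵥ B → (P i v ≡ deg D B v) × (∀ k → k ≢ i → P k v ≡ 𝟘)) →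
      ∀ k → F' k x ≡ F k x ∸² P k x
    F'-x-mono i on-B k with k ≟ i
    ... | yes refl = trans (proj₁ (F'-mono (mono-pattern⇒MonoEB i on-B) k) Fku≢𝟘)
                           (cong (F k x ∸²_) (sym (proj₁ (on-B x x∈B))))
      where
        Fku≢𝟘 : F k u ≢ 𝟘
        Fku≢𝟘 Fku≡𝟘 = biconnected-deg≢𝟘 bicB u∈B
          (trans (sym (proj₁ (on-B u u∈B))) (trans (agrees k u u∈B u≢x) Fku≡𝟘))
    ... | no k≢i = trans (proj₂ (F'-mono (mono-pattern⇒MonoEB i on-B) k) Fku≡𝟘)
                         (cong (F k x ∸²_) (sym (proj₂ (on-B x x∈B) k k≢i)))
      where
        Fku≡𝟘 : F k u ≡ 𝟘
        Fku≡𝟘 = trans (sym (agrees k u u∈B u≢x)) (proj₂ (on-B u u∈B) k k≢i)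

    F'-x-uniform : (∀ k → F' k x ≡ F k x ∸² F k u) → (∀ k → P k u ≡ P k x) →
      ∀ k → F' k x ≡ F k x ∸² P k x
    F'-x-uniform F'-x P-uniform k =
      trans (F'-x k) (cong (F k x ∸²_) (trans (sym (agrees k u u∈B u≢x)) (P-uniform k)))

    F'-x-pattern : BlockPattern P → ∀ k → F' k x ≡ F k x ∸² P k x
    F'-x-pattern (monochromatic i on-B)   = F'-x-mono i on-B
    F'-x-pattern (bicycle i j i≢j on-B)   =
      F'-x-uniform (F'-not-mono (two-colours⇒¬MonoEB i j i≢j (one i proj₁) (one j (proj₁ ∘ proj₂))))
                   (λ k → bicycle-uniform (_∈ᵥ B) on-B k u∈B x∈B)
      where
        one : ∀ c → (_ → P c u ≡ 𝟙) → F c u ≡ 𝟙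
        one c pick = trans (sym (agrees c u u∈B u≢x)) (pick (on-B u u∈B))
    F'-x-pattern (constant K P-constant) = F'-x-uniform (F'-x-complete K) (λ k → P-constant k u x u∈B x∈B)

  forward : Hard D full F → Hard D (contractSet B x) F'
  forward h = rest-hard F' (λ k v _ v≢x → F'≡F k v v≢x) (F'-x-pattern agrees below is-pattern)
    where open Peeled (peel h (λ _ _ → refl))

  block-split : Split D full B (contractSet B x) x
  block-split = mkSplit x∈B x∈contract full≡ meet apart
    where
      full≡ : ∀ v → true ≡ (B v ∨ contractSet B x v)
      full≡ v with B v
      ... | true  = refl
      ... | false = refl
      meet : ∀ v → v ∈ᵥ B → v ∈ᵥ contractSet B x → v ≡ x
      meet v v∈B v∈C = does⇒ (v ≟ x) (subst (λ b → (not b ∨ does (v ≟ x)) ≡ true) v∈B v∈C)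
      apart : ∀ a v → a ∈ᵥ B → v ∈ᵥ contractSet B x → a ≢ x → v ≢ x →
              (arc D a v ≡ false) × (arc D v a ≡ false)
      apart a v a∈B v∈C a≢x v≢x = ∨-conicalˡ _ _ a≁v , ∨-conicalʳ _ _ a≁v
        where
          a≁v : adjacent D a v ≡ false
          a≁v = sealed a∈B a≢x (¬-not (λ v∈B → v≢x (meet v v∈B v∈C)))

  glue-block : (P : Col s n) → Hard D B P → (∀ k v → v ∈ᵥ B → v ≢ x → F k v ≡ P k v) →
    (∀ k → F k x ≡ P k x +² F' k x) → Hard D (contractSet B x) F' → Hard D full F
  glue-block P hard-P on-B at-x =
    glue′ block-split (mkColourSplit on-B (λ k v _ v≢x → sym (F'≡F k v v≢x)) at-x) hard-P

  glue-uniform : Hard D B (λ k _ → F k u) → (∀ k v → v ∈ᵥ B → v ≢ x → F k v ≡ F k u) →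
    (∀ k → F k u ≤² F k x) → (∀ k → F' k x ≡ F k x ∸² F k u) →
    Hard D (contractSet B x) F' → Hard D full F
  glue-uniform hard-u on-B u≤x F'-x = glue-block (λ k _ → F k u) hard-u on-B λ k →
    trans (+-∸²-cancel (F k u) (F k x) (u≤x k)) (cong (F k u +²_) (sym (F'-x k)))

  backward-mono : MonoEB D F B x → Hard D (contractSet B x) F' → Hard D full F
  backward-mono isMono@(i , deg≤F , on-B) = glue-block P (mono bicB i (λ v _ → P-i v , P-other v)) F≡P at-x
    where
      P : Col s n
      P k v with k ≟ i
      ... | yes _ = deg D B v
      ... | no  _ = 𝟘
      P-i : ∀ v → P i v ≡ deg D B v
      P-i v with i ≟ i
      ... | yes _   = refl
      ... | no  i≢i = ⊥-elim (i≢i refl)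
      P-other : ∀ v k → k ≢ i → P k v ≡ 𝟘
      P-other v k k≢i with k ≟ i
      ... | yes k≡i = ⊥-elim (k≢i k≡i)
      ... | no  _   = refl
      F≡P : ∀ k v → v ∈ᵥ B → v ≢ x → F k v ≡ P k v
      F≡P k v v∈B v≢x with k ≟ i
      ... | yes refl = proj₁ (on-B v v∈B v≢x)
      ... | no  k≢i  = proj₂ (on-B v v∈B v≢x) k k≢i
      at-x : ∀ k → F k x ≡ P k x +² F' k x
      at-x k with k ≟ i
      ... | yes refl = trans (+-∸²-cancel (deg D B x) (F k x) deg≤F)
                             (cong (deg D B x +²_) (sym (proj₁ (F'-mono isMono k) Fku≢𝟘)))
        where
          Fku≢𝟘 : F k u ≢ 𝟘
          Fku≢𝟘 Fku≡𝟘 = biconnected-deg≢𝟘 bicB u∈B (trans (sym (proj₁ (on-B u u∈B u≢x))) Fku≡𝟘)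
      ... | no k≢i = sym (proj₂ (F'-mono isMono k) (proj₂ (on-B u u∈B u≢x) k k≢i))

  backward-bicycle : BicycleEB D F B x → Hard D (contractSet B x) F' → Hard D full F
  backward-bicycle (cyc , i , j , i≢j , 𝟙≤Fix , 𝟙≤Fjx , on-B) =
    glue-uniform (cycle cyc i j i≢j (λ _ _ → on-B u u∈B u≢x))
      (λ k v v∈B v≢x → bicycle-uniform (λ v → v ∈ᵥ B × v ≢ x) (λ v (v∈B , v≢x) → on-B v v∈B v≢x)
                         k (v∈B , v≢x) (u∈B , u≢x))
      u≤x (F'-not-mono (two-colours⇒¬MonoEB i j i≢j (proj₁ on-u) (proj₁ (proj₂ on-u))))
    where
      on-u : (F i u ≡ 𝟙) × (F j u ≡ 𝟙) × (∀ c → c ≢ i → c ≢ j → F c u ≡ 𝟘)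
      on-u = on-B u u∈B u≢x
      u≤x : ∀ k → F k u ≤² F k x
      u≤x k with k ≟ i
      ... | yes refl = subst (_≤² F k x) (sym (proj₁ on-u)) 𝟙≤Fix
      ... | no k≢i with k ≟ j
      ...   | yes refl = subst (_≤² F k x) (sym (proj₁ (proj₂ on-u))) 𝟙≤Fjx
      ...   | no  k≢j  = subst (_≤² F k x) (sym (proj₂ (proj₂ on-u) k k≢i k≢j)) (z≤n , z≤n)

  backward-complete : (∀ v → sumFin (λ k → proj₂ (F k v)) ≡ outdeg D full v) →
    CompleteEB D F B x → Hard D (contractSet B x) F' → Hard D full F
  backward-complete out-tight (K , F-constant , F-symmetric , F≤Fx) =
    glue-uniform (complete K (λ _ _ _ _ _ → refl) (λ k _ _ → F-symmetric k u u∈B u≢x) (λ _ _ → out-u))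
      (λ k v v∈B v≢x → F-constant k v u v∈B u∈B v≢x u≢x) (λ k → F≤Fx k u u∈B u≢x) (F'-x-complete K)
    where
      out-u : sumFin (λ k → proj₂ (F k u)) ≡ count B ∸ 1
      out-u = begin
        sumFin (λ k → proj₂ (F k u)) ≡⟨ out-tight u ⟩
        outdeg D full u              ≡⟨ outdeg-within (λ w w∉B → ∨-conicalˡ _ _ (sealed u∈B u≢x w∉B)) ⟩
        outdeg D B u                 ≡⟨ cong proj₂ (complete-deg K u∈B) ⟩
        count B ∸ 1                  ∎
        where open ≡-Reasoning

  backward : (∀ v → sumFin (λ k → proj₂ (F k v)) ≡ outdeg D full v) →
    MonoEB D F B x ⊎ BicycleEB D F B x ⊎ CompleteEB D F B x →
    Hard D (contractSet B x) F' → Hard D full F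
  backward _         (inj₁ isMono)        = backward-mono isMono
  backward _         (inj₂ (inj₁ bicyc))  = backward-bicycle bicyc
  backward out-tight (inj₂ (inj₂ compl))  = backward-complete out-tight compl

lemma15 : ∀ {n s} (D : Digraph n) (F : Col s n) →
    TightValid D F → ¬ Biconnected D full →
    ∀ (B : VSet n) (x : Fin n) → HardEndBlock D F B x →
    ∀ (u : Fin n) → u ∈ᵥ B → u ≢ x →
    ∀ (F' : Col s n) → IsContraction D B x u F F' →
    Hard D full F ⇔ Hard D (contractSet B x) F'
-- Non-biconnectivity of D only guarantees that an end-block exists.
lemma15 D F (_ , tight) _ B x (end-block , kind) u u∈B u≢x F' contraction =
  mk⇔ forward (backward (λ v → proj₂ (tight v)) kind)
  where open Contraction D F B x end-block u u∈B u≢x F' contraction
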